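{- Let $P$, $G$, $L_{ij}$ and $R_{ij}$ be as defined below, and let $T$ be an $L_{ij}$ partial tour subgraph. Then every connected component of $T$ contains either zero or an even number of vertices of $R_{ij}$ having odd degree in $T$.
   Context: $P$ is a finite set of points in the plane. Let $h$ (resp. $v$) be the number of distinct horizontal (resp. vertical) lines containing points of $P$; index horizontal lines $1,\dots,h$ from bottom to top and vertical lines $1,\dots,v$ from left to right, and let $v_{ij}$ be the intersection of horizontal line $i$ and vertical line $j$. $G$ is the undirected multigraph with vertex set $\{v_{ij}\}$ having, for each pair of consecutive intersection points on a common line, two parallel edges joining them, of length equal to their $l_1$ distance. A tour subgraph of $G$ is a sub-multigraph $T$ such that every point of $P$ is a vertex of $T$ and the edges of $T$ can be oriented to form a closed walk using each edge exactly once (equivalently: $T$ contains all points of $P$, is connected, and every vertex has even degree). $L_{ij}$ is the sub-multigraph of $G$ induced by the vertices $v_{r,c}$ with ($r \le i$ and $c \le j$) or ($r > i$ and $c \le j-1$). $R_{ij}$ is the set consisting, for each horizontal line $r$, of the rightmost vertex of $L_{ij}$ on that line. An $L_{ij}$ partial tour subgraph is a sub-multigraph $T$ of $L_{ij}$ for which there exists a sub-multigraph $F$ of $G$ containing no edge of $L_{ij}$ such that $T \cup F$ is a tour subgraph of $G$. -}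

module Defs where

open import Data.Nat using (ℕ; zero; suc; _+_)
open import Data.Fin using (Fin; zero; suc; toℕ)
open import Data.Fin.Properties using (_≟_)
open import Data.Bool using (Bool; true; false; _∧_; _∨_; if_then_else_)
open import Data.Maybe using (Maybe; just; nothing)
import Data.Maybe as M
open import Data.Product using (Σ; _×_; _,_; ∃)
open import Data.Sum using (_⊎_)
open import Data.List using (List; []; _∷_; concatMap; map)
open import Data.Nat.ListAction using (sum)
open import Data.Fin.Base using (_≤_; _<_)
import Data.Fin.Base as F
open import Data.List using () renaming (allFin to listFin)
open import Relation.Nullary using (¬_; does)
open import Relation.Binary.PropositionalEquality using (_≡_)

-- Horizontal lines are indexed by Fin h (0 = bottom), vertical lines by
-- Fin v (0 = leftmost).  The vertex v_{rc} is the pair (r , c).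
-- (0-based indices; paper's line i corresponds to Fin index i-1.)

Vertex : ℕ → ℕ → Set
Vertex h v = Fin h × Fin v

next : ∀ {n} → Fin n → Maybe (Fin n)
next {suc zero}    zero    = nothing
next {suc (suc n)} zero    = just (suc zero)
next {suc (suc n)} (suc k) = M.map suc (next {suc n} k)

-- An edge of G is named by its lower/left endpoint u, a direction, and
-- which of the two parallel copies it is.
data Dir : Set where
  right up : Dir

nbr : ∀ {h v} → Vertex h v → Dir → Maybe (Vertex h v)
nbr (r , c) right = M.map (λ c' → (r , c')) (next c)
nbr (r , c) up    = M.map (λ r' → (r' , c)) (next r)

record SubG (h v : ℕ) : Set where
  field
    V     : Vertex h v → Bool
    E     : Vertex h v → Dir → Fin 2 → Bool
    E-ok  : ∀ u d b → E u d b ≡ true →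
            Σ (Vertex h v) λ w → (nbr u d ≡ just w) × (V u ≡ true) × (V w ≡ true)
open SubG public

_∪G_ : ∀ {h v} → SubG h v → SubG h v → SubG h v
SubG.V (T ∪G F) x = V T x ∨ V F x
SubG.E (T ∪G F) u d b = E T u d b ∨ E F u d b
SubG.E-ok (T ∪G F) u d b eq with E T u d b in eT | E F u d b in eF
... | true  | _ with E-ok T u d b eT
...   | w , n , p , q = w , n , orL p , orL q
  where
  orL : ∀ {x y} → x ≡ true → (x ∨ y) ≡ true
  orL Relation.Binary.PropositionalEquality.refl = Relation.Binary.PropositionalEquality.refl
SubG.E-ok (T ∪G F) u d b eq | false | true with E-ok F u d b eF
...   | w , n , p , q = w , n , orR p , orR q
  where
  orR : ∀ {x y} → y ≡ true → (x ∨ y) ≡ true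
  orR {true}  _ = Relation.Binary.PropositionalEquality.refl
  orR {false} e = e
SubG.E-ok (T ∪G F) u d b () | false | false

eqV : ∀ {h v} → Vertex h v → Vertex h v → Bool
eqV (r , c) (r' , c') = does (r ≟ r') ∧ does (c ≟ c')

eqMV : ∀ {h v} → Maybe (Vertex h v) → Vertex h v → Bool
eqMV (just x) y = eqV x y
eqMV nothing  y = false

-- all edge names of G (including invalid ones, which are never present)
allEdgeNames : ∀ h v → List (Vertex h v × Dir × Fin 2)
allEdgeNames h v =
  concatMap (λ r → concatMap (λ c → concatMap (λ d → map (λ b → ((r , c) , d , b))
    (listFin 2)) (right ∷ up ∷ [])) (listFin v)) (listFin h)

deg : ∀ {h v} → SubG h v → Vertex h v → ℕ
deg {h} {v} T w = sum (map count (allEdgeNames h v))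
  where
  count : Vertex h v × Dir × Fin 2 → ℕ
  count (u , d , b) =
    if E T u d b ∧ (eqV u w ∨ eqMV (nbr u d) w) then 1 else 0

Adj : ∀ {h v} → SubG h v → Vertex h v → Vertex h v → Set
Adj {h} {v} T x y = Σ (Vertex h v) λ u → Σ Dir λ d → Σ (Fin 2) λ b →
  (E T u d b ≡ true) ×
  (((x ≡ u) × (nbr u d ≡ just y)) ⊎ ((y ≡ u) × (nbr u d ≡ just x)))

data Reach {h v} (T : SubG h v) : Vertex h v → Vertex h v → Set where
  here : ∀ {x} → Reach T x x
  step : ∀ {x y z} → Adj T x y → Reach T y z → Reach T x z

Connected : ∀ {h v} → SubG h v → Set
Connected T = ∀ x y → V T x ≡ true → V T y ≡ true → Reach T x y

data Even : ℕ → Set where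
  ev0 : Even 0
  ev2 : ∀ {n} → Even n → Even (suc (suc n))

Odd : ℕ → Set
Odd n = ¬ Even n

TourSubgraph : ∀ {h v} → (Vertex h v → Bool) → SubG h v → Set
TourSubgraph P T =
  (∀ x → P x ≡ true → V T x ≡ true) × Connected T ×
  (∀ x → V T x ≡ true → Even (deg T x))

-- vertices of L_{ij}: (r ≤ i and c ≤ j) or (r > i and c ≤ j-1)
-- (with 0-based indices "c ≤ j-1" becomes c < j)
InL : ∀ {h v} → Fin h → Fin v → Vertex h v → Set
InL i j (r , c) = ((r ≤ i) × (c ≤ j)) ⊎ ((i < r) × (c < j))

InR : ∀ {h v} → Fin h → Fin v → Vertex h v → Set
InR {h} {v} i j (r , c) = InL i j (r , c) × (∀ (c' : Fin v) → c < c' → ¬ InL i j (r , c'))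

EdgeInL : ∀ {h v} → Fin h → Fin v → Vertex h v → Dir → Set
EdgeInL {h} {v} i j u d = InL i j u × Σ (Vertex h v) λ w → (nbr u d ≡ just w) × InL i j w

SubOfL : ∀ {h v} → Fin h → Fin v → SubG h v → Set
SubOfL i j T = (∀ x → V T x ≡ true → InL i j x)
             × (∀ u d b → E T u d b ≡ true → EdgeInL i j u d)

PartialTour : ∀ {h v} → (Vertex h v → Bool) → Fin h → Fin v → SubG h v → Set
PartialTour {h} {v} P i j T = SubOfL i j T ×
  Σ (SubG h v) λ F → (∀ u d b → E F u d b ≡ true → ¬ EdgeInL i j u d)
                    × TourSubgraph P (T ∪G F)

-- P determines exactly h horizontal and v vertical lines
EveryLineUsed : ∀ {h v} → (Vertex h v → Bool) → Set
EveryLineUsed {h} {v} P =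
  (∀ (r : Fin h) → Σ (Fin v) λ c → P (r , c) ≡ true) ×
  (∀ (c : Fin v) → Σ (Fin h) λ r → P (r , c) ≡ true)

-- The vertices in question are the odd-degree vertices of T lying in the component C of x.
-- If w has odd degree in T, then, since T ∪ F has even degrees and T, F share no edge, w
-- also has odd degree in F; an F-edge at w is not an edge of L_ij, and because L_ij is
-- closed downwards and to the left, this forces w to be the rightmost vertex of L_ij on
-- its line. Every edge of T has both or neither endpoint in C, so the degrees in C sum to
-- an even number (handshake), and hence C contains an even number of odd-degree vertices.
-- C itself is obtained as a decidable set by saturating {x} along edges of T.

module Submission where

open import Defs
open import Data.Nat using (ℕ)
open import Data.Fin using (Fin)
open import Data.Bool using (Bool; true)
open import Data.Product using (_×_)
open import Data.List using (List; length)
open import Data.List.Membership.Propositional using (_∈_)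
open import Data.List.Relation.Unary.Unique.Propositional using (Unique)
open import Function.Bundles using (_⇔_)
open import Relation.Binary.PropositionalEquality using (_≡_)

open import Algebra.Properties.CommutativeSemigroup using (interchange)
open import Data.Bool using (false; _∧_; _∨_; if_then_else_)
import Data.Bool.Properties as B
open import Data.Bool.Properties using (if-eta)
open import Data.Empty using (⊥-elim)
open import Data.Fin using (toℕ; _≤_; _<_) renaming (zero to fzero; suc to fsuc)
import Data.Fin.Properties as FP
open import Data.List using ([]; _∷_; map; cartesianProduct; allFin)
open import Data.List.Membership.Propositional using (_∉_)
open import Data.List.Membership.Propositional.Properties using (∈-cartesianProduct⁺; ∈-allFin)
open import Data.List.Properties using (map-cong)
import Data.List.Relation.Unary.All as All
open import Data.List.Relation.Unary.AllPairs using ([]; _∷_)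
open import Data.List.Relation.Unary.Any using (here; there)
open import Data.List.Relation.Unary.Unique.Propositional.Properties
  using (cartesianProduct⁺; allFin⁺)
open import Data.Maybe using (just; nothing)
open import Data.Maybe.Properties using (just-injective)
open import Data.Nat using (zero; suc; _+_; parity)
open import Data.Nat.ListAction using (sum)
import Data.Nat.Properties as ℕ
open import Data.Nat.Properties using (+-identityʳ; +-comm; 1+n≢0; 1+n≢n)
open import Data.Parity using (0ℙ; 1ℙ) renaming (_+_ to _ℙ+_)
import Data.Parity.Properties as ℙ
open import Data.Product using (Σ; ∃; _,_; proj₁; proj₂)
open import Data.Sum using (_⊎_; inj₁; inj₂; [_,_])
open import Function using (_∘_; case_of_)
open import Function.Bundles using (mk⇔; Equivalence)
open import Relation.Nullary using (¬_; Dec; yes; no; does)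
open import Relation.Nullary.Decidable using (map′; _⊎-dec_; _×-dec_; ¬?; dec-true)
open import Relation.Binary.PropositionalEquality
  using (_≢_; refl; sym; trans; cong; cong₂; subst; module ≡-Reasoning)

private
  variable
    A : Set
    h v : ℕ

Even⇒parity≡0ℙ : ∀ {n} → Even n → parity n ≡ 0ℙ
Even⇒parity≡0ℙ ev0 = refl
Even⇒parity≡0ℙ (ev2 e) = Even⇒parity≡0ℙ e

parity≡0ℙ⇒Even : ∀ n → parity n ≡ 0ℙ → Even n
parity≡0ℙ⇒Even zero          _ = ev0
parity≡0ℙ⇒Even (suc zero)    ()
parity≡0ℙ⇒Even (suc (suc n)) p = ev2 (parity≡0ℙ⇒Even n p)

Odd⇔parity≡1ℙ : ∀ {n} → Odd n ⇔ parity n ≡ 1ℙ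
Odd⇔parity≡1ℙ {n} = mk⇔ to from
  where
  to : Odd n → parity n ≡ 1ℙ
  to odd with parity n in eq
  ... | 0ℙ = ⊥-elim (odd (parity≡0ℙ⇒Even n eq))
  ... | 1ℙ = refl
  from : parity n ≡ 1ℙ → Odd n
  from p e with () ← trans (sym p) (Even⇒parity≡0ℙ e)

even? : ∀ n → Dec (Even n)
even? n = map′ (parity≡0ℙ⇒Even n) Even⇒parity≡0ℙ (parity n ℙ.≟ 0ℙ)

Odd⇒≢0 : ∀ {n} → Odd n → n ≢ 0
Odd⇒≢0 odd refl = odd ev0

sum-map-cong : ∀ {f g : A → ℕ} xs → (∀ x → f x ≡ g x) → sum (map f xs) ≡ sum (map g xs)
sum-map-cong xs f≗g = cong sum (map-cong f≗g xs)

sum-map-zero : ∀ {f : A → ℕ} xs → (∀ x → f x ≡ 0) → sum (map f xs) ≡ 0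
sum-map-zero []       _  = refl
sum-map-zero (x ∷ xs) f0 = cong₂ _+_ (f0 x) (sum-map-zero xs f0)

sum-map-+ : ∀ (f g : A → ℕ) xs →
            sum (map (λ x → f x + g x) xs) ≡ sum (map f xs) + sum (map g xs)
sum-map-+ f g []       = refl
sum-map-+ f g (x ∷ xs) =
  trans (cong (f x + g x +_) (sum-map-+ f g xs))
        (interchange ℕ.+-commutativeSemigroup (f x) (g x) (sum (map f xs)) (sum (map g xs)))

sum-map-comm : ∀ {B : Set} (f : A → B → ℕ) xs ys →
               sum (map (λ x → sum (map (f x) ys)) xs) ≡
               sum (map (λ y → sum (map (λ x → f x y) xs)) ys)
sum-map-comm f []       ys = sym (sum-map-zero ys (λ _ → refl))
sum-map-comm f (x ∷ xs) ys =
  trans (cong (sum (map (f x) ys) +_) (sum-map-comm f xs ys))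
        (sym (sum-map-+ (f x) (λ y → sum (map (λ x → f x y) xs)) ys))

sum-map≢0⇒∃ : ∀ (f : A → ℕ) xs → sum (map f xs) ≢ 0 → ∃ λ x → f x ≢ 0
sum-map≢0⇒∃ f []       ≢0 = ⊥-elim (≢0 refl)
sum-map≢0⇒∃ f (x ∷ xs) ≢0 with f x in fx
... | zero  = sum-map≢0⇒∃ f xs ≢0
... | suc _ = x , λ fx≡0 → 1+n≢0 (trans (sym fx) fx≡0)

parity-sum-map-cong : ∀ {f g : A → ℕ} xs → (∀ x → parity (f x) ≡ parity (g x)) →
                      parity (sum (map f xs)) ≡ parity (sum (map g xs))
parity-sum-map-cong               []       _ = refl
parity-sum-map-cong {f = f} {g} (x ∷ xs) p = begin
  parity (f x + sum (map f xs))              ≡⟨ ℙ.+-homo-+ (f x) _ ⟩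
  parity (f x) ℙ+ parity (sum (map f xs))    ≡⟨ cong₂ _ℙ+_ (p x) (parity-sum-map-cong xs p) ⟩
  parity (g x) ℙ+ parity (sum (map g xs))    ≡⟨ sym (ℙ.+-homo-+ (g x) _) ⟩
  parity (g x + sum (map g xs))              ∎
  where
  open ≡-Reasoning

length≡sum-map-1 : (xs : List A) → length xs ≡ sum (map (λ _ → 1) xs)
length≡sum-map-1 []       = refl
length≡sum-map-1 (x ∷ xs) = cong suc (length≡sum-map-1 xs)

module _ (t : A → Bool) (f : A → ℕ) {a : A} (t⇒≡a : ∀ {x} → t x ≡ true → x ≡ a) where

  sum-map-if-∉ : ∀ {xs} → a ∉ xs → sum (map (λ x → if t x then f x else 0) xs) ≡ 0
  sum-map-if-∉ {[]}     _   = refl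
  sum-map-if-∉ {x ∷ xs} a∉ with t x in tx
  ... | true  = ⊥-elim (a∉ (here (sym (t⇒≡a tx))))
  ... | false = sum-map-if-∉ (a∉ ∘ there)

  sum-map-if-single : ∀ {xs} → Unique xs → a ∈ xs → t a ≡ true →
                      sum (map (λ x → if t x then f x else 0) xs) ≡ f a
  sum-map-if-single (a≢ ∷ _) (here refl) ta rewrite ta =
    trans (cong (f a +_) (sum-map-if-∉ (λ a∈ → All.lookup a≢ a∈ refl))) (+-identityʳ (f a))
  sum-map-if-single {x ∷ xs} (x≢ ∷ !xs) (there a∈) ta with t x in tx
  ... | true  = ⊥-elim (All.lookup x≢ a∈ (t⇒≡a tx))
  ... | false = sum-map-if-single !xs a∈ ta

vertices : ∀ h v → List (Vertex h v)
vertices h v = cartesianProduct (allFin h) (allFin v)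

vertices-unique : Unique (vertices h v)
vertices-unique {h} {v} = cartesianProduct⁺ (allFin⁺ h) (allFin⁺ v)

∈-vertices : (w : Vertex h v) → w ∈ vertices h v
∈-vertices (r , c) = ∈-cartesianProduct⁺ (∈-allFin r) (∈-allFin c)

∑ᵥ : (Vertex h v → ℕ) → ℕ
∑ᵥ {h} {v} f = sum (map f (vertices h v))

eqV-sound : (a b : Vertex h v) → eqV a b ≡ true → a ≡ b
eqV-sound (r , c) (r′ , c′) e with r FP.≟ r′ | c FP.≟ c′
... | yes refl | yes refl = refl

eqV-refl : (a : Vertex h v) → eqV a a ≡ true
eqV-refl (r , c) rewrite dec-true (r FP.≟ r) refl | dec-true (c FP.≟ c) refl = refl

∑ᵥ-if-eqV : (a : Vertex h v) (f : Vertex h v → ℕ) → ∑ᵥ (λ w → if eqV a w then f w else 0) ≡ f a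
∑ᵥ-if-eqV a f =
  sum-map-if-single (eqV a) f (sym ∘ eqV-sound a _) vertices-unique (∈-vertices a) (eqV-refl a)

length≡∑ᵥ : ∀ {ys : List (Vertex h v)} {Q : Vertex h v → Set} (Q? : ∀ w → Dec (Q w)) →
            Unique ys → (∀ w → w ∈ ys ⇔ Q w) → length ys ≡ ∑ᵥ (λ w → if does (Q? w) then 1 else 0)
length≡∑ᵥ {h} {v} {ys} Q? ys-unique ys⇔Q = begin
  length ys
    ≡⟨ length≡sum-map-1 ys ⟩
  sum (map (λ _ → 1) ys)
    ≡⟨ sum-map-cong ys (λ y → sym (∑ᵥ-if-eqV y (λ _ → 1))) ⟩
  sum (map (λ y → ∑ᵥ (λ w → if eqV y w then 1 else 0)) ys)
    ≡⟨ sum-map-comm (λ y w → if eqV y w then 1 else 0) ys (vertices h v) ⟩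
  ∑ᵥ (λ w → sum (map (λ y → if eqV y w then 1 else 0) ys))
    ≡⟨ sum-map-cong (vertices h v) multiplicity ⟩
  ∑ᵥ (λ w → if does (Q? w) then 1 else 0) ∎
  where
  open ≡-Reasoning
  multiplicity : ∀ w → sum (map (λ y → if eqV y w then 1 else 0) ys) ≡
                      (if does (Q? w) then 1 else 0)
  multiplicity w with Q? w
  ... | yes q = sum-map-if-single (λ y → eqV y w) (λ _ → 1) (eqV-sound _ w) ys-unique
                                  (Equivalence.from (ys⇔Q w) q) (eqV-refl w)
  ... | no ¬q = sum-map-if-∉ (λ y → eqV y w) (λ _ → 1) (eqV-sound _ w)
                             (¬q ∘ Equivalence.to (ys⇔Q w))

next-toℕ : ∀ {n} {k k′ : Fin n} → next k ≡ just k′ → toℕ k′ ≡ suc (toℕ k)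
next-toℕ {suc (suc n)} {fzero}  refl = refl
next-toℕ {suc (suc n)} {fsuc k} e with next {suc n} k in eq | e
... | just _ | refl = cong suc (next-toℕ eq)

nbr-right : ∀ {r : Fin h} {c : Fin v} {w} → nbr (r , c) right ≡ just w →
            ∃ λ c′ → toℕ c′ ≡ suc (toℕ c) × w ≡ (r , c′)
nbr-right {c = c} e with next c in eq | e
... | just c′ | refl = c′ , next-toℕ eq , refl

nbr-up : ∀ {r : Fin h} {c : Fin v} {w} → nbr (r , c) up ≡ just w →
         ∃ λ r′ → toℕ r′ ≡ suc (toℕ r) × w ≡ (r′ , c)
nbr-up {r = r} e with next r in eq | e
... | just r′ | refl = r′ , next-toℕ eq , refl

nbr-irrefl : ∀ (u : Vertex h v) d {w} → nbr u d ≡ just w → u ≢ w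
nbr-irrefl (r , c) right e refl with nbr-right e
... | c′ , c′≡1+c , refl = 1+n≢n (sym c′≡1+c)
nbr-irrefl (r , c) up    e refl with nbr-up e
... | r′ , r′≡1+r , refl = 1+n≢n (sym r′≡1+r)

toℕ≡suc⇒≤ : ∀ {n} {k k′ : Fin n} → toℕ k′ ≡ suc (toℕ k) → k ≤ k′
toℕ≡suc⇒≤ eq = ℕ.≤-trans (ℕ.n≤1+n _) (ℕ.≤-reflexive (sym eq))

nbr-≤ : ∀ (u : Vertex h v) d {w} → nbr u d ≡ just w →
               proj₁ u ≤ proj₁ w × proj₂ u ≤ proj₂ w
nbr-≤ _ right e with nbr-right e
... | _ , c′≡1+c , refl = ℕ.≤-refl , toℕ≡suc⇒≤ c′≡1+c
nbr-≤ _ up    e with nbr-up e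
... | _ , r′≡1+r , refl = toℕ≡suc⇒≤ r′≡1+r , ℕ.≤-refl

module _ {h v} (i : Fin h) (j : Fin v) where

  InL-downward : ∀ {r r′ c c′} → InL i j (r , c) → r′ ≤ r → c′ ≤ c → InL i j (r′ , c′)
  InL-downward (inj₁ (r≤i , c≤j)) r′≤r c′≤c = inj₁ (ℕ.≤-trans r′≤r r≤i , ℕ.≤-trans c′≤c c≤j)
  InL-downward {r′ = r′} (inj₂ (i<r , c<j)) r′≤r c′≤c with r′ FP.≤? i
  ... | yes r′≤i = inj₁ (r′≤i , ℕ.≤-trans c′≤c (ℕ.<⇒≤ c<j))
  ... | no  r′≰i = inj₂ (ℕ.≰⇒> r′≰i , ℕ.≤-<-trans c′≤c c<j)

  InL-up : ∀ {r r′ c c′} → InL i j (r , c′) → c < c′ → toℕ r′ ≡ suc (toℕ r) → InL i j (r′ , c)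
  InL-up {r′ = r′} (inj₁ (r≤i , c′≤j)) c<c′ _ with r′ FP.≤? i
  ... | yes r′≤i = inj₁ (r′≤i , ℕ.<⇒≤ (ℕ.<-≤-trans c<c′ c′≤j))
  ... | no  r′≰i = inj₂ (ℕ.≰⇒> r′≰i , ℕ.<-≤-trans c<c′ c′≤j)
  InL-up (inj₂ (i<r , c′<j)) c<c′ r′≡1+r =
    inj₂ (ℕ.<-≤-trans (ℕ.m<n⇒m<1+n i<r) (ℕ.≤-reflexive (sym r′≡1+r)) , ℕ.<-trans c<c′ c′<j)

  leaving-edge⇒InR : ∀ (u : Vertex h v) d {w y} → nbr u d ≡ just w → ¬ (InL i j u × InL i j w) →
                     InL i j y → u ≡ y ⊎ w ≡ y → InR i j y
  leaving-edge⇒InR u d nb edge⊈L y∈L (inj₂ refl) with nbr-≤ u d nb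
  ... | r≤r′ , c≤c′ = ⊥-elim (edge⊈L (InL-downward y∈L r≤r′ c≤c′ , y∈L))
  leaving-edge⇒InR _ right nb edge⊈L y∈L (inj₁ refl) with nbr-right nb
  ... | _ , c′≡1+c , refl = y∈L , λ _ c<c″ c″∈L →
    edge⊈L (y∈L , InL-downward c″∈L ℕ.≤-refl (ℕ.≤-trans (ℕ.≤-reflexive c′≡1+c) c<c″))
  leaving-edge⇒InR _ up    nb edge⊈L y∈L (inj₁ refl) with nbr-up nb
  ... | _ , r′≡1+r , refl = y∈L , λ _ c<c″ c″∈L → edge⊈L (y∈L , InL-up c″∈L c<c″ r′≡1+r)

-- The summand of `deg`: `deg T w` unfolds to `sum (map (incidence T w) (allEdgeNames h v))`.
incidence : SubG h v → Vertex h v → Vertex h v × Dir × Fin 2 → ℕ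
incidence T w (u , d , b) = if E T u d b ∧ (eqV u w ∨ eqMV (nbr u d) w) then 1 else 0

IncidentEdge : SubG h v → Vertex h v → Set
IncidentEdge {h} {v} T w = Σ (Vertex h v) λ u → Σ Dir λ d → Σ (Fin 2) λ b → E T u d b ≡ true ×
                           Σ (Vertex h v) λ w′ → nbr u d ≡ just w′ × (u ≡ w ⊎ w′ ≡ w)

deg≢0⇒incident : ∀ (T : SubG h v) w → deg T w ≢ 0 → IncidentEdge T w
deg≢0⇒incident {h} {v} T w deg≢0 with sum-map≢0⇒∃ (incidence T w) (allEdgeNames h v) deg≢0
... | (u , d , b) , inc≢0 with E T u d b in eT
...   | false = ⊥-elim (inc≢0 refl)
...   | true with E-ok T u d b eT
...     | w′ , nb , _ rewrite nb with eqV u w in u≟w | eqV w′ w in w′≟w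
...       | true  | _     = u , d , b , eT , w′ , nb , inj₁ (eqV-sound u w u≟w)
...       | false | true  = u , d , b , eT , w′ , nb , inj₂ (eqV-sound w′ w w′≟w)
...       | false | false = ⊥-elim (inc≢0 refl)

deg≢0⇒vertex : ∀ (T : SubG h v) w → deg T w ≢ 0 → V T w ≡ true
deg≢0⇒vertex T w deg≢0 with deg≢0⇒incident T w deg≢0
... | u , d , b , eT , _ , nb , u≡w⊎w′≡w with E-ok T u d b eT | u≡w⊎w′≡w
... | _ , _   , Vu , _   | inj₁ refl = Vu
... | _ , nb′ , _  , Vw′ | inj₂ refl with trans (sym nb) nb′
...   | refl = Vw′

deg-∪G : ∀ (T F : SubG h v) w → (∀ u d b → E T u d b ≡ true → E F u d b ≢ true) →
         deg (T ∪G F) w ≡ deg T w + deg F w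
deg-∪G {h} {v} T F w disjoint =
  trans (sum-map-cong (allEdgeNames h v) incidence-∪G)
        (sum-map-+ (incidence T w) (incidence F w) (allEdgeNames h v))
  where
  incidence-∪G : ∀ e → incidence (T ∪G F) w e ≡ incidence T w e + incidence F w e
  incidence-∪G (u , d , b) with E T u d b in eT | E F u d b in eF
  ... | true  | true  = ⊥-elim (disjoint u d b eT eF)
  ... | true  | false = sym (+-identityʳ _)
  ... | false | _     = refl

Closed : SubG h v → (Vertex h v → Bool) → Set
Closed T C = ∀ u d b {w} → E T u d b ≡ true → nbr u d ≡ just w → C u ≡ C w

Closed-Reach : ∀ {T : SubG h v} {C a b} → Closed T C → Reach T a b → C a ≡ C b
Closed-Reach closed here = refl
Closed-Reach closed (step (u , d , b , eT , inj₁ (refl , nb)) r) =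
  trans (closed u d b eT nb) (Closed-Reach closed r)
Closed-Reach closed (step (u , d , b , eT , inj₂ (refl , nb)) r) =
  trans (sym (closed u d b eT nb)) (Closed-Reach closed r)

handshake : ∀ (T : SubG h v) C → Closed T C →
            parity (∑ᵥ (λ w → if C w then deg T w else 0)) ≡ 0ℙ
handshake {h} {v} T C closed = begin
  parity (∑ᵥ (λ w → if C w then deg T w else 0))
    ≡⟨ cong parity (sum-map-cong (vertices h v) (λ w → if-sum (C w) (incidence T w))) ⟩
  parity (∑ᵥ (λ w → sum (map (λ e → if C w then incidence T w e else 0) edges)))
    ≡⟨ cong parity (sum-map-comm (λ w e → if C w then incidence T w e else 0)
                                 (vertices h v) edges) ⟩
  parity (sum (map (λ e → ∑ᵥ (λ w → if C w then incidence T w e else 0)) edges))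
    ≡⟨ parity-sum-map-cong edges edge-contribution-even ⟩
  parity (sum (map (λ _ → 0) edges))
    ≡⟨ cong parity (sum-map-zero edges (λ _ → refl)) ⟩
  0ℙ ∎
  where
  open ≡-Reasoning
  edges : List (Vertex h v × Dir × Fin 2)
  edges = allEdgeNames h v

  ι : Bool → ℕ
  ι c = if c then 1 else 0

  if-sum : ∀ c (f : _ → ℕ) →
           (if c then sum (map f edges) else 0) ≡ sum (map (λ e → if c then f e else 0) edges)
  if-sum true  f = refl
  if-sum false f = sym (sum-map-zero edges (λ _ → refl))

  edge-contribution-even : ∀ e → parity (∑ᵥ (λ w → if C w then incidence T w e else 0)) ≡ 0ℙ
  edge-contribution-even (u , d , b) with E T u d b in eT
  ... | false = cong parity (sum-map-zero (vertices h v) (λ w → if-eta (C w)))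
  ... | true with E-ok T u d b eT
  ...   | u′ , nb , _ rewrite nb = begin
    parity (∑ᵥ (λ w → if C w then ι (eqV u w ∨ eqV u′ w) else 0))
      ≡⟨ cong parity (trans (sum-map-cong (vertices h v) split) (sum-map-+ _ _ (vertices h v))) ⟩
    parity (∑ᵥ (λ w → if eqV u w then ι (C w) else 0) + ∑ᵥ (λ w → if eqV u′ w then ι (C w) else 0))
      ≡⟨ cong parity (cong₂ _+_ (∑ᵥ-if-eqV u (ι ∘ C)) (∑ᵥ-if-eqV u′ (ι ∘ C))) ⟩
    parity (ι (C u) + ι (C u′))
      ≡⟨ cong (λ c → parity (ι c + ι (C u′))) (closed u d b eT nb) ⟩
    parity (ι (C u′) + ι (C u′))
      ≡⟨ ℙ.+-homo-+ (ι (C u′)) (ι (C u′)) ⟩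
    parity (ι (C u′)) ℙ+ parity (ι (C u′))
      ≡⟨ ℙ.p+p≡0ℙ (parity (ι (C u′))) ⟩
    0ℙ ∎
    where
    split : ∀ w → (if C w then ι (eqV u w ∨ eqV u′ w) else 0) ≡
                  (if eqV u w then ι (C w) else 0) + (if eqV u′ w then ι (C w) else 0)
    split w with eqV u w in u≟w | eqV u′ w in u′≟w
    ... | true  | true  =
      ⊥-elim (nbr-irrefl u d nb (trans (eqV-sound u w u≟w) (sym (eqV-sound u′ w u′≟w))))
    ... | true  | false = sym (+-identityʳ _)
    ... | false | true  = refl
    ... | false | false = if-eta (C w)

∃-Vertex? : {P : Vertex h v → Set} → (∀ u → Dec (P u)) → Dec (∃ P)
∃-Vertex? P? = map′ (λ (r , c , p) → (r , c) , p) (λ ((r , c) , p) → r , c , p)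
                    (FP.any? λ r → FP.any? λ c → P? (r , c))

∃-Dir? : {P : Dir → Set} → (∀ d → Dec (P d)) → Dec (∃ P)
∃-Dir? P? = map′ [ (right ,_) , (up ,_) ] (λ { (right , p) → inj₁ p ; (up , p) → inj₂ p })
                 (P? right ⊎-dec P? up)

Reach-snoc : ∀ {T : SubG h v} {a b c} → Reach T a b → Adj T b c → Reach T a c
Reach-snoc here       adj = step adj here
Reach-snoc (step s r) adj = step s (Reach-snoc r adj)

module _ (T : SubG h v) (x : Vertex h v) where

  private
    CrossingAt : (Vertex h v → Bool) → Vertex h v → Dir → Fin 2 → Set
    CrossingAt C u d b = E T u d b ≡ true × ∃ λ w → nbr u d ≡ just w × C u ≢ C w

    crossingAt? : ∀ C u d b → Dec (CrossingAt C u d b)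
    crossingAt? C u d b with E T u d b in eT | nbr u d in nb
    ... | false | _       = no λ ()
    ... | true  | nothing = no λ ()
    ... | true  | just w with C u B.≟ C w
    ...   | no  Cu≢Cw = yes (refl , w , refl , Cu≢Cw)
    ...   | yes Cu≡Cw = no λ (_ , w′ , nb′ , Cu≢Cw′) →
      Cu≢Cw′ (trans Cu≡Cw (cong C (just-injective nb′)))

    Crossing : (Vertex h v → Bool) → Set
    Crossing C = ∃ λ u → ∃ λ d → ∃ λ b → CrossingAt C u d b

    crossing? : ∀ C → Dec (Crossing C)
    crossing? C = ∃-Vertex? λ u → ∃-Dir? λ d → FP.any? λ b → crossingAt? C u d b

    ¬Crossing⇒Closed : ∀ {C} → ¬ Crossing C → Closed T C
    ¬Crossing⇒Closed {C} ¬cross u d b {w} eT nb with C u B.≟ C w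
    ... | yes Cu≡Cw = Cu≡Cw
    ... | no  Cu≢Cw = ⊥-elim (¬cross (u , d , b , eT , w , nb , Cu≢Cw))

    Reached : (Vertex h v → Bool) → Set
    Reached C = C x ≡ true × (∀ w → C w ≡ true → Reach T x w)

    Crossing⇒unreached : ∀ {C} → Reached C → Crossing C → ∃ λ z → C z ≡ false × Reach T x z
    Crossing⇒unreached {C} (_ , reach) (u , d , b , eT , w , nb , Cu≢Cw) with C u in Cu | C w in Cw
    ... | true  | false = w , Cw , Reach-snoc (reach u Cu) (u , d , b , eT , inj₁ (refl , nb))
    ... | false | true  = u , Cu , Reach-snoc (reach w Cw) (u , d , b , eT , inj₂ (refl , nb))
    ... | true  | true  = ⊥-elim (Cu≢Cw refl)
    ... | false | false = ⊥-elim (Cu≢Cw refl)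

    insert : (Vertex h v → Bool) → Vertex h v → Vertex h v → Bool
    insert C z w = C w ∨ eqV z w

    Reached-insert : ∀ {C z} → Reached C → Reach T x z → Reached (insert C z)
    Reached-insert {C} {z} (Cx , reach) x⇝z = cong (_∨ eqV z x) Cx , reach′
      where
      reach′ : ∀ w → insert C z w ≡ true → Reach T x w
      reach′ w Cw∨z≡w with C w in Cw
      ... | true  = reach w Cw
      ... | false = subst (Reach T x) (eqV-sound z w Cw∨z≡w) x⇝z

    unreached : (Vertex h v → Bool) → ℕ
    unreached C = ∑ᵥ (λ w → if C w then 0 else 1)

    unreached-insert : ∀ {C z} → C z ≡ false → unreached C ≡ suc (unreached (insert C z))
    unreached-insert {C} {z} Cz≡false = begin
      unreached C
        ≡⟨ sum-map-cong (vertices h v) split ⟩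
      ∑ᵥ (λ w → (if insert C z w then 0 else 1) + (if eqV z w then 1 else 0))
        ≡⟨ sum-map-+ _ _ (vertices h v) ⟩
      unreached (insert C z) + ∑ᵥ (λ w → if eqV z w then 1 else 0)
        ≡⟨ cong (unreached (insert C z) +_) (∑ᵥ-if-eqV z (λ _ → 1)) ⟩
      unreached (insert C z) + 1
        ≡⟨ +-comm _ 1 ⟩
      suc (unreached (insert C z)) ∎
      where
      open ≡-Reasoning
      split : ∀ w → (if C w then 0 else 1) ≡
                    (if C w ∨ eqV z w then 0 else 1) + (if eqV z w then 1 else 0)
      split w with C w in Cw | eqV z w in z≟w
      ... | true  | true  =
        case trans (sym Cw) (trans (cong C (sym (eqV-sound z w z≟w))) Cz≡false) of λ ()
      ... | true  | false = refl
      ... | false | true  = refl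
      ... | false | false = refl

    Component : Set
    Component = ∃ λ C → Reached C × Closed T C

    explore : ∀ n C → unreached C ≡ n → Reached C → Component
    explore n C unreached≡n reached with crossing? C
    ... | no ¬cross = C , reached , ¬Crossing⇒Closed ¬cross
    ... | yes cross with Crossing⇒unreached reached cross
    ...   | z , Cz≡false , x⇝z =
      explore′ n (trans (sym (unreached-insert Cz≡false)) unreached≡n) (Reached-insert reached x⇝z)
      where
      explore′ : ∀ n → suc (unreached (insert C z)) ≡ n → Reached (insert C z) → Component
      explore′ (suc n) eq reached′ = explore n (insert C z) (ℕ.suc-injective eq) reached′

  component : ∃ λ C → Closed T C × (∀ w → C w ≡ true ⇔ Reach T x w)
  component with explore _ (eqV x) refl
                         (eqV-refl x , λ w x≟w → subst (Reach T x) (eqV-sound x w x≟w) here)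
  ... | C , (Cx , reach) , closed =
    C , closed , λ w → mk⇔ (reach w) (λ x⇝w → trans (sym (Closed-Reach closed x⇝w)) Cx)

PartialTour⇒odd-InR : ∀ {P : Vertex h v → Bool} {i j T w} → PartialTour P i j T →
                      Odd (deg T w) → InR i j w
PartialTour⇒odd-InR {i = i} {j} {T} {w} ((V⊆L , E⊆L) , F , F∩L≡∅ , _ , _ , evenDeg) degT-odd =
  let (u , d , b , eF , w′ , nb , u≡w⊎w′≡w) = deg≢0⇒incident F w (Odd⇒≢0 degF-odd)
  in leaving-edge⇒InR i j u d nb (λ (u∈L , w′∈L) → F∩L≡∅ u d b eF (u∈L , w′ , nb , w′∈L))
                      (V⊆L w Vw) u≡w⊎w′≡w
  where
  Vw : V T w ≡ true
  Vw = deg≢0⇒vertex T w (Odd⇒≢0 degT-odd)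

  degF-odd : Odd (deg F w)
  degF-odd = Equivalence.from Odd⇔parity≡1ℙ (ℙ.+-cancelˡ-≡ 1ℙ _ _ (begin
    1ℙ ℙ+ parity (deg F w)               ≡⟨ cong (_ℙ+ parity (deg F w)) degT-odd′ ⟨
    parity (deg T w) ℙ+ parity (deg F w) ≡⟨ ℙ.+-homo-+ (deg T w) (deg F w) ⟨
    parity (deg T w + deg F w)           ≡⟨ cong parity (deg-∪G T F w T∩F≡∅) ⟨
    parity (deg (T ∪G F) w)              ≡⟨ Even⇒parity≡0ℙ (evenDeg w (cong (_∨ V F w) Vw)) ⟩
    0ℙ                                   ∎))
    where
    open ≡-Reasoning
    degT-odd′ : parity (deg T w) ≡ 1ℙ
    degT-odd′ = Equivalence.to Odd⇔parity≡1ℙ degT-odd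
    T∩F≡∅ : ∀ u d b → E T u d b ≡ true → E F u d b ≢ true
    T∩F≡∅ u d b eT eF = F∩L≡∅ u d b eF (E⊆L u d b eT)

Closed⇒Even-odd-vertices : ∀ {T : SubG h v} {C ys} → Closed T C → Unique ys →
                           (∀ w → w ∈ ys ⇔ (C w ≡ true × Odd (deg T w))) → Even (length ys)
Closed⇒Even-odd-vertices {h} {v} {T} {C} {ys} closed ys-unique ys⇔oddInC =
  parity≡0ℙ⇒Even (length ys) (begin
    parity (length ys)
      ≡⟨ cong parity (length≡∑ᵥ oddInC? ys-unique ys⇔oddInC) ⟩
    parity (∑ᵥ (λ w → if does (oddInC? w) then 1 else 0))
      ≡⟨ parity-sum-map-cong (vertices h v) count-parity ⟩
    parity (∑ᵥ (λ w → if C w then deg T w else 0))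
      ≡⟨ handshake T C closed ⟩
    0ℙ ∎)
  where
  open ≡-Reasoning
  oddInC? : ∀ w → Dec (C w ≡ true × Odd (deg T w))
  oddInC? w = C w B.≟ true ×-dec ¬? (even? (deg T w))

  count-parity : ∀ w → parity (if does (oddInC? w) then 1 else 0) ≡
                       parity (if C w then deg T w else 0)
  count-parity w with C w | parity (deg T w) in p
  ... | false | _  = refl
  ... | true  | 0ℙ = sym p
  ... | true  | 1ℙ = sym p

lemma4 : ∀ {h v : ℕ} (P : Vertex h v → Bool) → EveryLineUsed P →
         (i : Fin h) (j : Fin v) (T : SubG h v) → PartialTour P i j T →
         (x : Vertex h v) → V T x ≡ true →
         (ys : List (Vertex h v)) → Unique ys →
         (∀ y → (y ∈ ys) ⇔ (InR i j y × V T y ≡ true × Reach T x y × Odd (deg T y))) →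
         Even (length ys)
lemma4 P _ i j T partial x _ ys ys-unique ys-spec =
  let (C , closed , C⇔Reach) = component T x
  in Closed⇒Even-odd-vertices {T = T} {C} closed ys-unique λ w → mk⇔
       (λ w∈ys → let (_ , _ , x⇝w , odd) = Equivalence.to (ys-spec w) w∈ys
                 in Equivalence.from (C⇔Reach w) x⇝w , odd)
       (λ (Cw , odd) → Equivalence.from (ys-spec w)
         ( PartialTour⇒odd-InR partial odd , deg≢0⇒vertex T w (Odd⇒≢0 odd)
         , Equivalence.to (C⇔Reach w) Cw , odd))
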